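{- Let $\alpha\in Fm''$. Then either every completed tableau of $\mathbb T$ for $F(\alpha)$ is open, or every completed tableau of $\mathbb T$ for $F(\alpha)$ is closed.
   Context: Formulas of $Fm''$ are built from propositional variables with unary $\neg$ and binary $\succ$. Signed formulas are $T(\alpha)$, $F(\alpha)$. Rules of $\mathbb T$ (premise $\Rightarrow$ conclusion sets separated by $|$): $T(\alpha\succ\beta)\Rightarrow \{T(\beta)\}\,|\,\{T(\neg\alpha),F(\beta),T(\neg\beta)\}\,|\,\{F(\alpha),F(\beta),F(\neg\beta)\}$; $F(\alpha\succ\beta)\Rightarrow\{T(\alpha),F(\beta),F(\neg\beta)\}\,|\,\{F(\neg\alpha),F(\beta),T(\neg\beta)\}$; $T(\neg(\alpha\succ\beta))\Rightarrow\{T(\alpha),F(\beta),T(\neg\beta)\}\,|\,\{F(\neg\alpha),T(\beta),T(\neg\beta)\}$; $F(\neg(\alpha\succ\beta))\Rightarrow\{F(\neg\beta)\}\,|\,\{T(\neg\alpha),T(\beta),T(\neg\beta)\}\,|\,\{F(\alpha),F(\beta),T(\neg\beta)\}$; $T(\neg\neg\alpha)\Rightarrow\{T(\alpha)\}$; $F(\neg\neg\alpha)\Rightarrow\{F(\alpha)\}$. A tableau for $\eta$ is a finite tree with root $\eta$ built by repeatedly choosing a non-closed branch and a signed formula on it that is a rule premise, and extending the branch by one sub-branch per conclusion set. A branch is closed if it contains $T(\gamma)$ and $F(\gamma)$ for some $\gamma$, open otherwise; a tableau is closed if all branches are closed and open otherwise; it is completed if on every non-closed branch every rule whose premise occurs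 on the branch has been applied to it along that branch. -}

module Defs where

open import Data.Nat using (ℕ)
open import Data.Fin using (Fin)
open import Data.List using (List; []; _∷_; _++_; length; lookup; [_])
open import Data.List.Membership.Propositional using (_∈_)
open import Data.Maybe using (Maybe; just; nothing)
open import Data.Product using (Σ; _×_)
open import Relation.Nullary using (¬_)
open import Relation.Binary.PropositionalEquality using (_≡_)

data Fm : Set where
  var  : ℕ → Fm
  ~_   : Fm → Fm
  _≻_  : Fm → Fm → Fm

infix 30 ~_
infixr 20 _≻_

data Signed : Set where
  T : Fm → Signed
  F : Fm → Signed

-- The rules of 𝕋: premise ↦ list of conclusion sets (nothing = not a premise)
rule : Signed → Maybe (List (List Signed))
rule (T (a ≻ b))       = just ( (T b ∷ [])
                              ∷ (T (~ a) ∷ F b ∷ T (~ b) ∷ [])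
                              ∷ (F a ∷ F b ∷ F (~ b) ∷ []) ∷ [])
rule (F (a ≻ b))       = just ( (T a ∷ F b ∷ F (~ b) ∷ [])
                              ∷ (F (~ a) ∷ F b ∷ T (~ b) ∷ []) ∷ [])
rule (T (~ (a ≻ b)))   = just ( (T a ∷ F b ∷ T (~ b) ∷ [])
                              ∷ (F (~ a) ∷ T b ∷ T (~ b) ∷ []) ∷ [])
rule (F (~ (a ≻ b)))   = just ( (F (~ b) ∷ [])
                              ∷ (T (~ a) ∷ T b ∷ T (~ b) ∷ [])
                              ∷ (F a ∷ F b ∷ T (~ b) ∷ []) ∷ [])
rule (T (~ (~ a)))     = just ((T a ∷ []) ∷ [])
rule (F (~ (~ a)))     = just ((F a ∷ []) ∷ [])
rule (T (var _))       = nothing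
rule (F (var _))       = nothing
rule (T (~ (var _)))   = nothing
rule (F (~ (var _)))   = nothing

IsPremise : Signed → Set
IsPremise φ = Σ (List (List Signed)) λ cs → rule φ ≡ just cs

ClosedBranch : List Signed → Set
ClosedBranch Γ = Σ Fm λ γ → (T γ ∈ Γ) × (F γ ∈ Γ)

-- Tableaux: Tab Γ is a tableau-tree continuing a branch whose formulas so far are Γ.
data Tab (Γ : List Signed) : Set where
  leaf : Tab Γ
  node : (φ : Signed) → φ ∈ Γ → ¬ ClosedBranch Γ →
         (cs : List (List Signed)) → rule φ ≡ just cs →
         ((i : Fin (length cs)) → Tab (Γ ++ lookup cs i)) → Tab Γ

Tableau : Signed → Set
Tableau η = Tab [ η ]

Closed : ∀ {Γ} → Tab Γ → Set
Closed {Γ} leaf = ClosedBranch Γ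
Closed (node _ _ _ cs _ ch) = (i : Fin (length cs)) → Closed (ch i)

Open : ∀ {Γ} → Tab Γ → Set
Open t = ¬ Closed t

-- A = formulas to which a
-- rule was applied along the path so far.
CompletedFrom : ∀ {Γ} → List Signed → Tab Γ → Set
CompletedFrom {Γ} A leaf =
  ¬ ClosedBranch Γ → (φ : Signed) → φ ∈ Γ → IsPremise φ → φ ∈ A
CompletedFrom A (node φ _ _ cs _ ch) =
  (i : Fin (length cs)) → CompletedFrom (φ ∷ A) (ch i)

Completed : ∀ {Γ} → Tab Γ → Set
Completed t = CompletedFrom [] t

-- Each rule of 𝕋 is invertible for the two-valued semantics in which p and ¬p
-- get independent values: a model satisfies the premise iff it satisfies every
-- member of some conclusion set.  Hence a model of F(α) runs down some branch
-- of every tableau, which therefore stays open; and an open branch of a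
-- completed tableau is a Hintikka set, so it has a model, read off its atomic
-- formulas.  Whether F(α) has a model is decidable, since only the finitely
-- many variables of α matter.
module Submission where

open import Defs
open import Data.Bool using (Bool; true; false; not)
open import Data.Bool.Properties using () renaming (_≟_ to _≟ᵇ_)
open import Data.Empty using (⊥; ⊥-elim)
open import Data.Fin using (Fin)
open import Data.List using (List; []; _∷_; _++_; length; lookup; [_])
open import Data.List.Membership.Propositional using (_∈_; find; lose)
open import Data.List.Membership.Propositional.Properties using (∈-++⁺ˡ; ∈-++⁺ʳ; ∈-lookup)
open import Data.List.Relation.Unary.All as All using (All; []; _∷_)
open import Data.List.Relation.Unary.All.Properties using (++⁺; ++⁻ˡ)
open import Data.List.Relation.Unary.Any as Any using (Any; here; there; any?)
open import Data.List.Relation.Unary.Any.Properties using (lookup-index)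
open import Data.Maybe using (just)
open import Data.Nat using (ℕ) renaming (_≟_ to _≟ℕ_)
open import Data.Product using (Σ; ∃; _×_; _,_; proj₁)
open import Data.Sum using (_⊎_; inj₁; inj₂)
open import Function using (_∘_)
open import Relation.Binary.Definitions using (DecidableEquality)
open import Relation.Binary.PropositionalEquality using (_≡_; refl; sym; trans; cong; cong₂)
open import Relation.Nullary using (¬_; Dec; yes; no; does)
open import Relation.Nullary.Decidable using (map′; _×-dec_; _⊎-dec_; dec-true; dec-false)

_≟ᶠ_ : DecidableEquality Fm
var m ≟ᶠ var n = map′ (cong var) (λ { refl → refl }) (m ≟ℕ n)
(~ a) ≟ᶠ (~ b) = map′ (cong ~_) (λ { refl → refl }) (a ≟ᶠ b)
(a ≻ b) ≟ᶠ (c ≻ d) =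
  map′ (λ (p , q) → cong₂ _≻_ p q) (λ { refl → refl , refl }) (a ≟ᶠ c ×-dec b ≟ᶠ d)
var _   ≟ᶠ (~ _)   = no λ ()
var _   ≟ᶠ (_ ≻ _) = no λ ()
(~ _)   ≟ᶠ var _   = no λ ()
(~ _)   ≟ᶠ (_ ≻ _) = no λ ()
(_ ≻ _) ≟ᶠ var _   = no λ ()
(_ ≻ _) ≟ᶠ (~ _)   = no λ ()

_≟ˢ_ : DecidableEquality Signed
T a ≟ˢ T b = map′ (cong T) (λ { refl → refl }) (a ≟ᶠ b)
F a ≟ˢ F b = map′ (cong F) (λ { refl → refl }) (a ≟ᶠ b)
T _ ≟ˢ F _ = no λ ()
F _ ≟ˢ T _ = no λ ()

open import Data.List.Membership.DecPropositional _≟ˢ_ using (_∈?_)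

ClashesIn : List Signed → Signed → Set
ClashesIn Γ (T γ) = F γ ∈ Γ
ClashesIn Γ (F γ) = ⊥

closed? : (Γ : List Signed) → Dec (ClosedBranch Γ)
closed? Γ = map′ clash (λ (γ , Tγ , Fγ) → lose Tγ Fγ) (any? clashes? Γ)
  where
  clashes? : (φ : Signed) → Dec (ClashesIn Γ φ)
  clashes? (T γ) = F γ ∈? Γ
  clashes? (F γ) = no λ ()

  clash : Any (ClashesIn Γ) Γ → ClosedBranch Γ
  clash c with find c
  ... | T γ , Tγ , Fγ = γ , Tγ , Fγ

Val : Set
Val = ℕ → Bool

-- The truth tables of α ≻ β and of ¬(α ≻ β) in terms of the values of
-- α, ¬α, β, ¬β; they are read off from the rules of 𝕋.
imp : Bool → Bool → Bool → Bool → Bool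
imp a na true  nb    = true
imp a na false true  = na
imp a na false false = not a

nimp : Bool → Bool → Bool → Bool → Bool
nimp a na b     false = false
nimp a na true  true  = not na
nimp a na false true  = a

-- ρ gives the value of each variable p and σ, independently, that of ¬p;
-- nval γ is the value of ¬γ, so that ¬¬γ gets the value of γ.
val nval : Val → Val → Fm → Bool
val  ρ σ (var n) = ρ n
val  ρ σ (~ a)   = nval ρ σ a
val  ρ σ (a ≻ b) = imp (val ρ σ a) (nval ρ σ a) (val ρ σ b) (nval ρ σ b)
nval ρ σ (var n) = σ n
nval ρ σ (~ a)   = val ρ σ a
nval ρ σ (a ≻ b) = nimp (val ρ σ a) (nval ρ σ a) (val ρ σ b) (nval ρ σ b)

formula : Signed → Fm
formula (T γ) = γ
formula (F γ) = γ

sign : Signed → Bool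
sign (T _) = true
sign (F _) = false

Sat : Val → Val → Signed → Set
Sat ρ σ φ = val ρ σ (formula φ) ≡ sign φ

Satisfiable : List Signed → Set
Satisfiable Γ = Σ Val λ ρ → Σ Val λ σ → All (Sat ρ σ) Γ

module _ {ρ σ : Val} where

  -- Omitted value combinations falsify the premise; the coverage checker
  -- discharges them through s.
  rule-sound : ∀ {φ cs} → rule φ ≡ just cs → Sat ρ σ φ → Any (All (Sat ρ σ)) cs
  rule-sound {T (a ≻ b)} refl s
    with val ρ σ a in x | nval ρ σ a in nx | val ρ σ b in y | nval ρ σ b in ny | s
  ... | _     | _     | true  | _     | _ = here (y ∷ [])
  ... | _     | true  | false | true  | _ = there (here (nx ∷ y ∷ ny ∷ []))
  ... | false | _     | false | false | _ = there (there (here (x ∷ y ∷ ny ∷ [])))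
  rule-sound {F (a ≻ b)} refl s
    with val ρ σ a in x | nval ρ σ a in nx | val ρ σ b in y | nval ρ σ b in ny | s
  ... | true  | _     | false | false | _ = here (x ∷ y ∷ ny ∷ [])
  ... | _     | false | false | true  | _ = there (here (nx ∷ y ∷ ny ∷ []))
  rule-sound {T (~ (a ≻ b))} refl s
    with val ρ σ a in x | nval ρ σ a in nx | val ρ σ b in y | nval ρ σ b in ny | s
  ... | true  | _     | false | true  | _ = here (x ∷ y ∷ ny ∷ [])
  ... | _     | false | true  | true  | _ = there (here (nx ∷ y ∷ ny ∷ []))
  rule-sound {F (~ (a ≻ b))} refl s
    with val ρ σ a in x | nval ρ σ a in nx | val ρ σ b in y | nval ρ σ b in ny | s
  ... | _     | _     | _     | false | _ = here (ny ∷ [])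
  ... | _     | true  | true  | true  | _ = there (here (nx ∷ y ∷ ny ∷ []))
  ... | false | _     | false | true  | _ = there (there (here (x ∷ y ∷ ny ∷ [])))
  rule-sound {T (~ (~ a))} refl s = here (s ∷ [])
  rule-sound {F (~ (~ a))} refl s = here (s ∷ [])

  rule-invertible : ∀ {φ cs} → rule φ ≡ just cs → Any (All (Sat ρ σ)) cs → Sat ρ σ φ
  rule-invertible {T (a ≻ b)} refl (here (y ∷ [])) rewrite y = refl
  rule-invertible {T (a ≻ b)} refl (there (here (nx ∷ y ∷ ny ∷ []))) rewrite nx | y | ny = refl
  rule-invertible {T (a ≻ b)} refl (there (there (here (x ∷ y ∷ ny ∷ [])))) rewrite x | y | ny = refl
  rule-invertible {F (a ≻ b)} refl (here (x ∷ y ∷ ny ∷ [])) rewrite x | y | ny = refl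
  rule-invertible {F (a ≻ b)} refl (there (here (nx ∷ y ∷ ny ∷ []))) rewrite nx | y | ny = refl
  rule-invertible {T (~ (a ≻ b))} refl (here (x ∷ y ∷ ny ∷ [])) rewrite x | y | ny = refl
  rule-invertible {T (~ (a ≻ b))} refl (there (here (nx ∷ y ∷ ny ∷ []))) rewrite nx | y | ny = refl
  rule-invertible {F (~ (a ≻ b))} refl (here (ny ∷ [])) rewrite ny = refl
  rule-invertible {F (~ (a ≻ b))} refl (there (here (nx ∷ y ∷ ny ∷ []))) rewrite nx | y | ny = refl
  rule-invertible {F (~ (a ≻ b))} refl (there (there (here (x ∷ y ∷ ny ∷ [])))) rewrite x | y | ny = refl
  rule-invertible {T (~ (~ a))} refl (here (x ∷ [])) = x
  rule-invertible {F (~ (~ a))} refl (here (x ∷ [])) = x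

  satisfied-branch-open : ∀ {Γ} → All (Sat ρ σ) Γ → (t : Tab Γ) → Open t
  satisfied-branch-open sat leaf (γ , Tγ , Fγ)
    with trans (sym (All.lookup sat Tγ)) (All.lookup sat Fγ)
  ... | ()
  satisfied-branch-open sat (node φ φ∈Γ _ cs eq sub) closed =
    satisfied-branch-open (++⁺ sat (lookup-index c)) (sub (Any.index c)) (closed (Any.index c))
    where
    c : Any (All (Sat ρ σ)) cs
    c = rule-sound eq (All.lookup sat φ∈Γ)

Expanded : List Signed → Signed → Set
Expanded Γ φ = ∀ {cs} → rule φ ≡ just cs → Any (All (_∈ Γ)) cs

Saturated : List Signed → Set
Saturated Γ = ∀ {φ} → φ ∈ Γ → IsPremise φ → Expanded Γ φ

Expanded-++ʳ : ∀ {Γ} Δ {φ} → Expanded Γ φ → Expanded (Γ ++ Δ) φ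
Expanded-++ʳ Δ expanded eq = Any.map (All.map ∈-++⁺ˡ) (expanded eq)

expanded-by-child : ∀ {Γ φ cs} → rule φ ≡ just cs →
                    (i : Fin (length cs)) → Expanded (Γ ++ lookup cs i) φ
expanded-by-child {Γ} eq i eq′ with trans (sym eq) eq′
... | refl = lose (∈-lookup i) (All.tabulate (∈-++⁺ʳ Γ))

module Hintikka {Γ : List Signed} (open-branch : ¬ ClosedBranch Γ) (saturated : Saturated Γ) where

  ρ σ : Val
  ρ n = does (T (var n) ∈? Γ)
  σ n = does (T (~ var n) ∈? Γ)

  Holds : Signed → Set
  Holds φ = φ ∈ Γ → Sat ρ σ φ

  premise-holds : ∀ {φ cs} → rule φ ≡ just cs → All (All Holds) cs → Holds φ
  premise-holds eq conclusions-hold φ∈Γ with find (saturated φ∈Γ (_ , eq) eq)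
  ... | c , c∈cs , c⊆Γ =
    rule-invertible eq (lose c∈cs (All.zipWith (λ (h , m) → h m) (All.lookup conclusions-hold c∈cs , c⊆Γ)))

  -- Every conclusion of a rule whose premise is about γ or ¬γ is about a proper
  -- subformula of γ or its negation, so induction on γ carries all four signs.
  record Good (γ : Fm) : Set where
    field
      T-holds  : Holds (T γ)
      F-holds  : Holds (F γ)
      T¬-holds : Holds (T (~ γ))
      F¬-holds : Holds (F (~ γ))

  good : ∀ γ → Good γ
  good (var n) = record
    { T-holds  = dec-true (T (var n) ∈? Γ)
    ; F-holds  = λ Fγ → dec-false (T (var n) ∈? Γ) (λ Tγ → open-branch (var n , Tγ , Fγ))
    ; T¬-holds = dec-true (T (~ var n) ∈? Γ)
    ; F¬-holds = λ Fγ → dec-false (T (~ var n) ∈? Γ) (λ Tγ → open-branch (~ var n , Tγ , Fγ))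
    }
  good (~ a) = record
    { T-holds  = T¬-holds
    ; F-holds  = F¬-holds
    ; T¬-holds = premise-holds refl ((T-holds ∷ []) ∷ [])
    ; F¬-holds = premise-holds refl ((F-holds ∷ []) ∷ [])
    }
    where open Good (good a)
  good (a ≻ b) = record
    { T-holds  = premise-holds refl ( (Tb ∷ [])
                                    ∷ (T¬a ∷ Fb ∷ T¬b ∷ [])
                                    ∷ (Fa ∷ Fb ∷ F¬b ∷ []) ∷ [])
    ; F-holds  = premise-holds refl ( (Ta ∷ Fb ∷ F¬b ∷ [])
                                    ∷ (F¬a ∷ Fb ∷ T¬b ∷ []) ∷ [])
    ; T¬-holds = premise-holds refl ( (Ta ∷ Fb ∷ T¬b ∷ [])
                                    ∷ (F¬a ∷ Tb ∷ T¬b ∷ []) ∷ [])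
    ; F¬-holds = premise-holds refl ( (F¬b ∷ [])
                                    ∷ (T¬a ∷ Tb ∷ T¬b ∷ [])
                                    ∷ (Fa ∷ Fb ∷ T¬b ∷ []) ∷ [])
    }
    where
    open Good (good a) renaming (T-holds to Ta; F-holds to Fa; T¬-holds to T¬a; F¬-holds to F¬a)
    open Good (good b) renaming (T-holds to Tb; F-holds to Fb; T¬-holds to T¬b; F¬-holds to F¬b)

  satisfiable : Satisfiable Γ
  satisfiable = ρ , σ , All.tabulate holds
    where
    holds : ∀ {φ} → Holds φ
    holds {T γ} = Good.T-holds (good γ)
    holds {F γ} = Good.F-holds (good γ)

completed-tableau-closed : ∀ {Γ A} → ¬ Satisfiable Γ → (t : Tab Γ) →
                           CompletedFrom A t → All (Expanded Γ) A → Closed t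
completed-tableau-closed {Γ} unsat leaf completed expanded with closed? Γ
... | yes closed = closed
... | no open-branch = ⊥-elim (unsat (Hintikka.satisfiable open-branch saturated))
  where
  saturated : Saturated Γ
  saturated φ∈Γ premise = All.lookup expanded (completed open-branch _ φ∈Γ premise)
completed-tableau-closed {Γ} unsat (node φ _ _ cs eq sub) completed expanded i =
  completed-tableau-closed
    (λ (ρ , σ , sat) → unsat (ρ , σ , ++⁻ˡ Γ sat))
    (sub i) (completed i)
    (expanded-by-child eq i ∷ All.map (Expanded-++ʳ (lookup cs i)) expanded)

vars : Fm → List ℕ
vars (var n) = [ n ]
vars (~ a)   = vars a
vars (a ≻ b) = vars a ++ vars b

Agree : List ℕ → Val → Val → Set
Agree xs ρ ρ′ = ∀ {x} → x ∈ xs → ρ x ≡ ρ′ x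

val-agree : ∀ γ {ρ σ ρ′ σ′} → Agree (vars γ) ρ ρ′ → Agree (vars γ) σ σ′ →
            val ρ σ γ ≡ val ρ′ σ′ γ × nval ρ σ γ ≡ nval ρ′ σ′ γ
val-agree (var n) agρ agσ = agρ (here refl) , agσ (here refl)
val-agree (~ a) agρ agσ with val-agree a agρ agσ
... | va , nva = nva , va
val-agree (a ≻ b) agρ agσ
  with val-agree a (agρ ∘ ∈-++⁺ˡ) (agσ ∘ ∈-++⁺ˡ)
     | val-agree b (agρ ∘ ∈-++⁺ʳ (vars a)) (agσ ∘ ∈-++⁺ʳ (vars a))
... | va , nva | vb , nvb rewrite va | nva | vb | nvb = refl , refl

_[_↦_] : Val → ℕ → Bool → Val
(ρ [ x ↦ b ]) y with y ≟ℕ x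
... | yes _ = b
... | no  _ = ρ y

update-agree : ∀ {xs ρ ρ′} x b → Agree xs ρ ρ′ → Agree (x ∷ xs) (ρ [ x ↦ b ]) (ρ′ [ x ↦ b ])
update-agree x b ag {y} y∈x∷xs with y ≟ℕ x | y∈x∷xs
... | yes _  | _          = refl
... | no y≢x | here y≡x   = ⊥-elim (y≢x y≡x)
... | no _   | there y∈xs = ag y∈xs

update-same : ∀ {xs ρ x b} → ρ x ≡ b → Agree xs ρ (ρ [ x ↦ b ])
update-same {x = x} ρx≡b {y} _ with y ≟ℕ x
... | yes refl = ρx≡b
... | no  _    = refl

DependsOn : List ℕ → (Val → Set) → Set
DependsOn xs P = ∀ {ρ ρ′} → Agree xs ρ ρ′ → P ρ → P ρ′

∃-dec : ∀ xs {P : Val → Set} → DependsOn xs P → (∀ ρ → Dec (P ρ)) → Dec (∃ P)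
∃-dec [] depends P? = map′ (_ ,_) (λ (ρ , p) → depends (λ ()) p) (P? (λ _ → false))
∃-dec (x ∷ xs) {P} depends P? =
  map′ forget-x choose-x (∃-dec xs depends′ λ ρ → P? (ρ [ x ↦ true ]) ⊎-dec P? (ρ [ x ↦ false ]))
  where
  P′ : Val → Set
  P′ ρ = P (ρ [ x ↦ true ]) ⊎ P (ρ [ x ↦ false ])

  depends′ : DependsOn xs P′
  depends′ ag (inj₁ p) = inj₁ (depends (update-agree x true ag) p)
  depends′ ag (inj₂ p) = inj₂ (depends (update-agree x false ag) p)

  forget-x : ∃ P′ → ∃ P
  forget-x (_ , inj₁ p) = _ , p
  forget-x (_ , inj₂ p) = _ , p

  choose-x : ∃ P → ∃ P′
  choose-x (ρ , p) with ρ x in ρx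
  ... | true  = ρ , inj₁ (depends (update-same ρx) p)
  ... | false = ρ , inj₂ (depends (update-same ρx) p)

satisfiable? : (φ : Signed) → Dec (Satisfiable [ φ ])
satisfiable? φ =
  ∃-dec xs (λ ag (σ , s) → σ , Sat-agree ag (λ _ → refl) s) λ ρ →
  ∃-dec xs (Sat-agree (λ _ → refl)) λ σ →
  map′ (_∷ []) All.head (val ρ σ (formula φ) ≟ᵇ sign φ)
  where
  xs : List ℕ
  xs = vars (formula φ)

  Sat-agree : ∀ {ρ σ ρ′ σ′} → Agree xs ρ ρ′ → Agree xs σ σ′ →
              All (Sat ρ σ) [ φ ] → All (Sat ρ′ σ′) [ φ ]
  Sat-agree agρ agσ (s ∷ []) = trans (sym (proj₁ (val-agree (formula φ) agρ agσ))) s ∷ []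

corollary5p9 : (α : Fm) →
    ((t : Tableau (F α)) → Completed t → Open t)
    ⊎ ((t : Tableau (F α)) → Completed t → Closed t)
corollary5p9 α with satisfiable? (F α)
... | yes (ρ , σ , sat) = inj₁ λ t _ → satisfied-branch-open sat t
... | no unsat          = inj₂ λ t completed → completed-tableau-closed unsat t completed []
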